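{- For positive integers $n$ and non-negative integers $T,E$, let $G_n[T,E]$ denote the number of sequences $(s_1,\dots,s_n)$ of non-negative integers such that $s_1\le s_2\le\cdots\le s_n$, $\sum_{i=1}^r s_i>\binom{r}{2}$ for all $1\le r<n$, $s_n=E$, and $\sum_{i=1}^n s_i=T$. Then $$G_1[T,E]=\begin{cases}1&\text{if }T=E,\\0&\text{otherwise},\end{cases}$$ and for $n\ge2$, $$G_n[T,E]=\begin{cases}\displaystyle\sum_{k=\lceil (T-E)/(n-1)\rceil}^{E} G_{n-1}[T-E,k] & \text{if } T-E>\binom{n-1}{2},\\[2mm] 0&\text{otherwise},\end{cases}$$ where an empty sum is $0$. -}

module Defs where

open import Data.Nat using (ℕ; zero; suc; _+_; _∸_; _<_; _≤_; _≤?_; _<?_; _/_)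
open import Data.Nat.Properties using (_≟_)
open import Data.Nat.Combinatorics using (_C_)
open import Data.List using (List; []; _∷_; length; filter; map; concatMap; take; upTo; applyUpTo)
open import Data.Nat.ListAction using (sum)
open import Data.List.Relation.Unary.All using (All)
open import Data.List.Relation.Unary.All.Properties using ()
import Data.List.Relation.Unary.All as All
open import Data.List.Relation.Unary.Linked using (Linked; linked?)
open import Data.Vec using (Vec; []; _∷_; toList; last)
open import Data.Product using (_×_)
open import Relation.Nullary using (Dec; _×-dec_)
open import Relation.Binary.PropositionalEquality using (_≡_)

-- A sequence (s₁,…,sₙ) is a Vec ℕ n with s₁ at the head.

Good : (m T E : ℕ) → Vec ℕ (suc m) → Set
Good m T E s =
  Linked _≤_ (toList s)
  × All (λ r → r C 2 < sum (take r (toList s))) (applyUpTo suc m)   -- r = 1,…,n-1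
  × last s ≡ E
  × sum (toList s) ≡ T

good? : (m T E : ℕ) → (s : Vec ℕ (suc m)) → Dec (Good m T E s)
good? m T E s =
  linked? _≤?_ (toList s)
  ×-dec All.all? (λ r → r C 2 <? sum (take r (toList s))) (applyUpTo suc m)
  ×-dec (last s ≟ E)
  ×-dec (sum (toList s) ≟ T)

vecsUpTo : (B n : ℕ) → List (Vec ℕ n)
vecsUpTo B zero    = [] ∷ []
vecsUpTo B (suc n) = concatMap (λ x → map (x ∷_) (vecsUpTo B n)) (upTo (suc B))

-- Any such sequence
-- consists of non-negative integers summing to T, so each entry is ≤ T and
-- the sequence occurs (exactly once) in vecsUpTo T n.
-- G is only meaningful for positive n; G 0 T E = 0 is an irrelevant convention.
G : ℕ → ℕ → ℕ → ℕ
G zero    T E = 0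
G (suc m) T E = length (filter (good? m T E) (vecsUpTo T (suc m)))

-- ⌈ a / d ⌉ for d ≥ 1, written (a + d - 1) / d.
ceilDiv : (a d : ℕ) → ℕ
ceilDiv a zero    = 0
ceilDiv a (suc d) = (a + d) / suc d

-- ∑_{k=a}^{b} f k  (empty sum = 0 when a > b).
sumFromTo : ℕ → ℕ → (ℕ → ℕ) → ℕ
sumFromTo a b f = sum (map f (applyUpTo (a +_) (suc b ∸ a)))

-- Removing the last entry E of a sequence counted by G_n[T,E] (n ≥ 2) leaves a
-- sequence counted by G_{n-1}[T-E,k] for its last entry k ≤ E; conversely such a
-- sequence extends by E exactly when the one remaining partial-sum condition,
-- (n-1 choose 2) < T-E, holds. Summing over k gives the recursion; the terms with
-- k < ⌈(T-E)/(n-1)⌉ vanish because a non-decreasing sequence of length n-1 ending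
-- in k sums to at most (n-1)k. Both counts are written as sums of indicators over
-- the enumeration vecsUpTo, split at its last coordinate; the enumeration bound T
-- can be lowered to T-E because no entry exceeds the total sum.

module Submission where

open import Defs
open import Level using (Level)
open import Data.Nat using (ℕ; zero; suc; _+_; _*_; _∸_; _<_; _≤_; _<?_; _≤?_; s≤s)
open import Data.Nat.Properties
open import Data.Nat.Combinatorics using (_C_)
open import Data.Nat.DivMod using (m<n*o⇒m/o<n)
open import Data.Nat.ListAction using (sum)
open import Data.Nat.ListAction.Properties using (sum-++)
open import Algebra.Properties.CommutativeSemigroup +-commutativeSemigroup using (interchange)
open import Data.List
  using (List; []; _∷_; _++_; [_]; map; concatMap; upTo; applyUpTo; take; length; filter)
open import Data.List.Properties using (map-++; upTo-∷ʳ; applyUpTo-∷ʳ; take-all)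
open import Data.List.Relation.Unary.All as All using (All; []; _∷_)
open import Data.List.Relation.Unary.All.Properties as Allₚ using (applyUpTo⁺₁; applyUpTo⁻)
open import Data.List.Relation.Unary.Linked using (Linked; [-]; _∷_)
open import Data.Vec using (Vec; []; _∷_; toList; last; _∷ʳ_)
open import Data.Vec.Properties using (last-∷ʳ; length-toList)
import Data.Vec.Relation.Unary.All as Vecᴬ
open import Data.Product using (_×_; _,_)
open import Data.Sum using (inj₁; inj₂)
open import Function.Bundles using (_⇔_; mk⇔; module Equivalence)
open import Relation.Nullary using (¬_; Dec; yes; no; _×-dec_; contradiction)
open import Relation.Unary using (Pred; Decidable)
open import Relation.Binary.PropositionalEquality
  using (_≡_; _≢_; refl; sym; trans; cong; cong₂; subst; subst₂; module ≡-Reasoning)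

open Equivalence using (to; from)

private
  variable
    a b p q : Level
    A : Set a
    B : Set b
    P : Set p
    Q : Set q

ind : Dec P → ℕ
ind (yes _) = 1
ind (no _)  = 0

ind-yes : P → (d : Dec P) → ind d ≡ 1
ind-yes _  (yes _) = refl
ind-yes x  (no ¬x) = contradiction x ¬x

ind-no : ¬ P → (d : Dec P) → ind d ≡ 0
ind-no ¬x (yes x) = contradiction x ¬x
ind-no _  (no _)  = refl

ind≢0⇒ : (d : Dec P) → ind d ≢ 0 → P
ind≢0⇒ (yes x) _   = x
ind≢0⇒ (no _)  ≢0 = contradiction refl ≢0

ind-cong : P ⇔ Q → (d : Dec P) (e : Dec Q) → ind d ≡ ind e
ind-cong P⇔Q (yes x) e = sym (ind-yes (to P⇔Q x) e)
ind-cong P⇔Q (no ¬x) e = sym (ind-no (λ y → ¬x (from P⇔Q y)) e)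

ind-× : (d : Dec P) (e : Dec Q) → ind (d ×-dec e) ≡ ind d * ind e
ind-× (yes _) (yes _) = refl
ind-× (yes _) (no _)  = refl
ind-× (no _)  _       = refl

∑ : List A → (A → ℕ) → ℕ
∑ xs f = sum (map f xs)

infix 5 ∑
syntax ∑ xs (λ x → t) = ∑[ x ∈ xs ] t

∑-cong : (xs : List A) {f g : A → ℕ} → (∀ x → f x ≡ g x) → ∑ xs f ≡ ∑ xs g
∑-cong []       f≗g = refl
∑-cong (x ∷ xs) f≗g = cong₂ _+_ (f≗g x) (∑-cong xs f≗g)

∑-zero : {xs : List A} {f : A → ℕ} → All (λ x → f x ≡ 0) xs → ∑ xs f ≡ 0
∑-zero []         = refl
∑-zero (fx≡0 ∷ h) = cong₂ _+_ fx≡0 (∑-zero h)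

∑-+ : (xs : List A) (f g : A → ℕ) → ∑[ x ∈ xs ] (f x + g x) ≡ ∑ xs f + ∑ xs g
∑-+ []       f g = refl
∑-+ (x ∷ xs) f g = trans (cong (f x + g x +_) (∑-+ xs f g)) (interchange (f x) (g x) _ _)

∑-*ˡ : (xs : List A) (c : ℕ) (f : A → ℕ) → ∑[ x ∈ xs ] c * f x ≡ c * ∑ xs f
∑-*ˡ []       c f = sym (*-zeroʳ c)
∑-*ˡ (x ∷ xs) c f = trans (cong (c * f x +_) (∑-*ˡ xs c f)) (sym (*-distribˡ-+ c (f x) _))

∑-*ʳ : (xs : List A) (c : ℕ) (f : A → ℕ) → ∑[ x ∈ xs ] f x * c ≡ ∑ xs f * c
∑-*ʳ xs c f = trans (∑-cong xs (λ x → *-comm (f x) c)) (trans (∑-*ˡ xs c f) (*-comm c _))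

∑-++ : (xs ys : List A) (f : A → ℕ) → ∑ (xs ++ ys) f ≡ ∑ xs f + ∑ ys f
∑-++ xs ys f = trans (cong sum (map-++ f xs ys)) (sum-++ (map f xs) (map f ys))

∑-map : (xs : List A) (g : A → B) (f : B → ℕ) → ∑ (map g xs) f ≡ ∑[ x ∈ xs ] f (g x)
∑-map []       g f = refl
∑-map (x ∷ xs) g f = cong (f (g x) +_) (∑-map xs g f)

∑-concatMap : (xs : List A) (g : A → List B) (f : B → ℕ) →
              ∑ (concatMap g xs) f ≡ ∑[ x ∈ xs ] ∑ (g x) f
∑-concatMap []       g f = refl
∑-concatMap (x ∷ xs) g f =
  trans (∑-++ (g x) (concatMap g xs) f) (cong (∑ (g x) f +_) (∑-concatMap xs g f))

∑-comm : (xs : List A) (ys : List B) (h : A → B → ℕ) →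
         ∑[ x ∈ xs ] ∑[ y ∈ ys ] h x y ≡ ∑[ y ∈ ys ] ∑[ x ∈ xs ] h x y
∑-comm []       ys h = sym (∑-zero (All.universal (λ _ → refl) ys))
∑-comm (x ∷ xs) ys h = trans (cong (∑ ys (h x) +_) (∑-comm xs ys h))
                             (sym (∑-+ ys (h x) (λ y → ∑[ x ∈ xs ] h x y)))

applyUpTo-+ : ∀ m n (g : ℕ → A) →
              applyUpTo g (m + n) ≡ applyUpTo g m ++ applyUpTo (λ i → g (m + i)) n
applyUpTo-+ zero    n g = refl
applyUpTo-+ (suc m) n g = cong (g 0 ∷_) (applyUpTo-+ m n (λ i → g (suc i)))

∑-upTo-+ : ∀ m n (f : ℕ → ℕ) → ∑ (upTo (m + n)) f ≡ ∑ (upTo m) f + ∑ (applyUpTo (m +_) n) f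
∑-upTo-+ m n f = trans (cong (λ xs → ∑ xs f) (applyUpTo-+ m n (λ i → i))) (∑-++ (upTo m) _ f)

∑-δ : ∀ n j → ∑[ k ∈ upTo n ] ind (k ≟ j) ≡ ind (j <? n)
∑-δ zero    j = sym (ind-no (λ ()) (j <? 0))
∑-δ (suc n) j = begin
  ∑ (upTo (suc n)) δ             ≡⟨ cong (λ ks → ∑ ks δ) (upTo-∷ʳ n) ⟨
  ∑ (upTo n ++ [ n ]) δ          ≡⟨ ∑-++ (upTo n) [ n ] δ ⟩
  ∑ (upTo n) δ + (δ n + 0)       ≡⟨ cong (_+ (δ n + 0)) (∑-δ n j) ⟩
  ind (j <? n) + (δ n + 0)       ≡⟨ step (j <? n) (n ≟ j) ⟩
  ind (j <? suc n)               ∎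
  where
    open ≡-Reasoning
    δ : ℕ → ℕ
    δ k = ind (k ≟ j)
    step : (j<n? : Dec (j < n)) (n≡j? : Dec (n ≡ j)) →
           ind j<n? + (ind n≡j? + 0) ≡ ind (j <? suc n)
    step (yes j<n) (yes refl) = contradiction j<n (<-irrefl refl)
    step (yes j<n) (no _)     = sym (ind-yes (m<n⇒m<1+n j<n) _)
    step (no _)    (yes refl) = sym (ind-yes ≤-refl _)
    step (no j≮n)  (no n≢j)   = sym (ind-no j≮1+n _)
      where
        j≮1+n : ¬ j < suc n
        j≮1+n j<1+n with m<1+n⇒m<n∨m≡n j<1+n
        ... | inj₁ j<n = j≮n j<n
        ... | inj₂ j≡n = n≢j (sym j≡n)

length-filter≡∑ : {P : Pred A p} (P? : Decidable P) (xs : List A) →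
                  length (filter P? xs) ≡ ∑[ x ∈ xs ] ind (P? x)
length-filter≡∑ P? []       = refl
length-filter≡∑ P? (x ∷ xs) with P? x
... | yes _ = cong suc (length-filter≡∑ P? xs)
... | no _  = length-filter≡∑ P? xs

∑-vecsUpTo-∷ : ∀ B n (f : Vec ℕ (suc n) → ℕ) →
               ∑ (vecsUpTo B (suc n)) f ≡ ∑[ x ∈ upTo (suc B) ] ∑[ v ∈ vecsUpTo B n ] f (x ∷ v)
∑-vecsUpTo-∷ B n f = trans (∑-concatMap (upTo (suc B)) (λ x → map (x ∷_) (vecsUpTo B n)) f)
                           (∑-cong (upTo (suc B)) (λ x → ∑-map (vecsUpTo B n) (x ∷_) f))

∑-vecsUpTo-∷ʳ : ∀ B n (f : Vec ℕ (suc n) → ℕ) →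
                ∑ (vecsUpTo B (suc n)) f ≡ ∑[ x ∈ upTo (suc B) ] ∑[ v ∈ vecsUpTo B n ] f (v ∷ʳ x)
∑-vecsUpTo-∷ʳ B zero    f = ∑-vecsUpTo-∷ B zero f
∑-vecsUpTo-∷ʳ B (suc n) f = begin
  ∑ (vecsUpTo B (suc (suc n))) f
    ≡⟨ ∑-vecsUpTo-∷ B (suc n) f ⟩
  ∑[ y ∈ U ] ∑[ v ∈ vecsUpTo B (suc n) ] f (y ∷ v)
    ≡⟨ ∑-cong U (λ y → ∑-vecsUpTo-∷ʳ B n (λ v → f (y ∷ v))) ⟩
  ∑[ y ∈ U ] ∑[ x ∈ U ] ∑[ w ∈ vecsUpTo B n ] f (y ∷ (w ∷ʳ x))
    ≡⟨ ∑-comm U U _ ⟩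
  ∑[ x ∈ U ] ∑[ y ∈ U ] ∑[ w ∈ vecsUpTo B n ] f (y ∷ (w ∷ʳ x))
    ≡⟨ ∑-cong U (λ x → ∑-vecsUpTo-∷ B n (λ v → f (v ∷ʳ x))) ⟨
  ∑[ x ∈ U ] ∑[ v ∈ vecsUpTo B (suc n) ] f (v ∷ʳ x) ∎
  where
    open ≡-Reasoning
    U : List ℕ
    U = upTo (suc B)

∑-vecsUpTo-bound : ∀ {B B′} n (f : Vec ℕ n → ℕ) → B ≤ B′ →
                   (∀ v → f v ≢ 0 → Vecᴬ.All (_≤ B) v) →
                   ∑ (vecsUpTo B′ n) f ≡ ∑ (vecsUpTo B n) f
∑-vecsUpTo-bound         zero    f B≤B′ bounded = refl
∑-vecsUpTo-bound {B} {B′} (suc n) f B≤B′ bounded = begin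
  ∑ (vecsUpTo B′ (suc n)) f
    ≡⟨ ∑-vecsUpTo-∷ B′ n f ⟩
  ∑ (upTo (suc B′)) F′
    ≡⟨ cong (λ k → ∑ (upTo (suc k)) F′) (m+[n∸m]≡n B≤B′) ⟨
  ∑ (upTo (suc B + (B′ ∸ B))) F′
    ≡⟨ ∑-upTo-+ (suc B) (B′ ∸ B) F′ ⟩
  ∑ (upTo (suc B)) F′ + ∑ (applyUpTo (suc B +_) (B′ ∸ B)) F′
    ≡⟨ cong₂ _+_ (∑-cong (upTo (suc B)) inside)
                 (∑-zero (Allₚ.applyUpTo⁺₂ (suc B +_) (B′ ∸ B) outside)) ⟩
  ∑ (upTo (suc B)) F + 0
    ≡⟨ +-identityʳ _ ⟩
  ∑ (upTo (suc B)) F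
    ≡⟨ ∑-vecsUpTo-∷ B n f ⟨
  ∑ (vecsUpTo B (suc n)) f ∎
  where
    open ≡-Reasoning
    F′ F : ℕ → ℕ
    F′ x = ∑[ v ∈ vecsUpTo B′ n ] f (x ∷ v)
    F  x = ∑[ v ∈ vecsUpTo B n ] f (x ∷ v)
    inside : ∀ x → F′ x ≡ F x
    inside x = ∑-vecsUpTo-bound n (λ v → f (x ∷ v)) B≤B′
                 (λ v fxv≢0 → Vecᴬ.tail (bounded (x ∷ v) fxv≢0))
    vanishes : ∀ x v → B < x → f (x ∷ v) ≡ 0
    vanishes x v B<x with f (x ∷ v) ≟ 0
    ... | yes fxv≡0 = fxv≡0
    ... | no fxv≢0  = contradiction (Vecᴬ.head (bounded (x ∷ v) fxv≢0)) (<⇒≱ B<x)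
    outside : ∀ i → F′ (suc B + i) ≡ 0
    outside i =
      ∑-zero (All.universal (λ v → vanishes (suc B + i) v (s≤s (m≤m+n B i))) (vecsUpTo B′ n))

∑-upTo-dropInitial : ∀ {a} n (g : ℕ → ℕ) → (∀ {k} → k < a → g k ≡ 0) →
                     ∑ (applyUpTo (a +_) (n ∸ a)) g ≡ ∑ (upTo n) g
∑-upTo-dropInitial {a} n g below with a ≤? n
... | yes a≤n = begin
  ∑ (applyUpTo (a +_) (n ∸ a)) g
    ≡⟨ cong (_+ ∑ (applyUpTo (a +_) (n ∸ a)) g) (∑-zero (applyUpTo⁺₁ (λ k → k) a below)) ⟨
  ∑ (upTo a) g + ∑ (applyUpTo (a +_) (n ∸ a)) g
    ≡⟨ ∑-upTo-+ a (n ∸ a) g ⟨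
  ∑ (upTo (a + (n ∸ a))) g
    ≡⟨ cong (λ k → ∑ (upTo k) g) (m+[n∸m]≡n a≤n) ⟩
  ∑ (upTo n) g ∎
  where open ≡-Reasoning
... | no a≰n  = begin
  ∑ (applyUpTo (a +_) (n ∸ a)) g
    ≡⟨ cong (λ k → ∑ (applyUpTo (a +_) k) g) (m≤n⇒m∸n≡0 (<⇒≤ n<a)) ⟩
  0
    ≡⟨ ∑-zero (applyUpTo⁺₁ (λ k → k) n (λ k<n → below (<-trans k<n n<a))) ⟨
  ∑ (upTo n) g ∎
  where
    open ≡-Reasoning
    n<a : n < a
    n<a = ≰⇒> a≰n

sum-∷ʳ : ∀ {n} (v : Vec ℕ n) x → sum (toList (v ∷ʳ x)) ≡ sum (toList v) + x
sum-∷ʳ []      x = +-identityʳ x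
sum-∷ʳ (y ∷ v) x = trans (cong (y +_) (sum-∷ʳ v x)) (sym (+-assoc y _ x))

take-∷ʳ : ∀ {n} (v : Vec A n) x r → r ≤ n → take r (toList (v ∷ʳ x)) ≡ take r (toList v)
take-∷ʳ v       x zero    _         = refl
take-∷ʳ (y ∷ v) x (suc r) (s≤s r≤n) = cong (y ∷_) (take-∷ʳ v x r r≤n)

take-toList : ∀ {n} (v : Vec A n) → take n (toList v) ≡ toList v
take-toList {n = n} v = take-all n (toList v) (≤-reflexive (length-toList v))

Linked-∷ʳ⁻ : ∀ {n} (v : Vec ℕ (suc n)) x →
             Linked _≤_ (toList (v ∷ʳ x)) → Linked _≤_ (toList v) × last v ≤ x
Linked-∷ʳ⁻ (y ∷ [])    x (y≤x ∷ _) = [-] , y≤x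
Linked-∷ʳ⁻ (y ∷ z ∷ w) x (y≤z ∷ l) =
  let l′ , last≤x = Linked-∷ʳ⁻ (z ∷ w) x l in (y≤z ∷ l′) , last≤x

Linked-∷ʳ⁺ : ∀ {n} (v : Vec ℕ (suc n)) x →
             Linked _≤_ (toList v) → last v ≤ x → Linked _≤_ (toList (v ∷ʳ x))
Linked-∷ʳ⁺ (y ∷ [])    x _         y≤x    = y≤x ∷ [-]
Linked-∷ʳ⁺ (y ∷ z ∷ w) x (y≤z ∷ l) last≤x = y≤z ∷ Linked-∷ʳ⁺ (z ∷ w) x l last≤x

head≤last : ∀ {n} y (v : Vec ℕ n) → Linked _≤_ (toList (y ∷ v)) → y ≤ last (y ∷ v)
head≤last y []      _         = ≤-refl
head≤last y (z ∷ v) (y≤z ∷ l) = ≤-trans y≤z (head≤last z v l)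

sum≤length*last : ∀ {n} (v : Vec ℕ (suc n)) → Linked _≤_ (toList v) →
                  sum (toList v) ≤ suc n * last v
sum≤length*last (y ∷ [])    _         = ≤-refl
sum≤length*last (y ∷ z ∷ v) (y≤z ∷ l) =
  +-mono-≤ (head≤last y (z ∷ v) (y≤z ∷ l)) (sum≤length*last (z ∷ v) l)

entries≤sum : ∀ {n} (v : Vec ℕ n) → Vecᴬ.All (_≤ sum (toList v)) v
entries≤sum []      = Vecᴬ.[]
entries≤sum (y ∷ v) =
  m≤m+n y _ Vecᴬ.∷ Vecᴬ.map (λ z≤s → ≤-trans z≤s (m≤n+m _ y)) (entries≤sum v)

ceilDiv-least : ∀ {t d k} → t ≤ suc d * k → ceilDiv t (suc d) ≤ k
ceilDiv-least {t} {d} {k} t≤[1+d]k = m<1+n⇒m≤n (m<n*o⇒m/o<n (begin-strict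
  t + d                ≤⟨ +-monoˡ-≤ d t≤[1+d]k ⟩
  suc d * k + d        <⟨ +-monoʳ-< (suc d * k) (n<1+n d) ⟩
  suc d * k + suc d    ≡⟨ +-comm (suc d * k) (suc d) ⟩
  suc d + suc d * k    ≡⟨ cong (suc d +_) (*-comm (suc d) k) ⟩
  suc k * suc d        ∎))
  where open ≤-Reasoning

PrefixSumsAbove : ℕ → List ℕ → Set
PrefixSumsAbove m xs = All (λ r → r C 2 < sum (take r xs)) (applyUpTo suc m)

PrefixSumsAbove-∷ʳ : ∀ {n} (v : Vec ℕ n) x →
                     PrefixSumsAbove n (toList (v ∷ʳ x)) ⇔ PrefixSumsAbove n (toList v)
PrefixSumsAbove-∷ʳ {n} v x = mk⇔
  (λ ps → applyUpTo⁺₁ suc n (λ {i} i<n → subst (Above i) (same-prefix i<n) (applyUpTo⁻ suc n ps i<n)))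
  (λ ps → applyUpTo⁺₁ suc n (λ {i} i<n → subst (Above i) (sym (same-prefix i<n)) (applyUpTo⁻ suc n ps i<n)))
  where
    same-prefix : ∀ {i} → i < n → take (suc i) (toList (v ∷ʳ x)) ≡ take (suc i) (toList v)
    same-prefix = take-∷ʳ v x _
    Above : ℕ → List ℕ → Set
    Above i ys = suc i C 2 < sum ys

PrefixSumsAbove-suc : ∀ m xs →
                      PrefixSumsAbove (suc m) xs ⇔ (PrefixSumsAbove m xs × suc m C 2 < sum (take (suc m) xs))
PrefixSumsAbove-suc m xs = mk⇔
  (λ ps → let psₘ , ps₁₊ₘ = Allₚ.++⁻ (applyUpTo suc m) (subst (All _) (sym split) ps)
          in  psₘ , All.head ps₁₊ₘ)
  (λ (psₘ , c) → subst (All _) split (Allₚ.++⁺ psₘ (c ∷ [])))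
  where
    split : applyUpTo suc m ++ [ suc m ] ≡ applyUpTo suc (suc m)
    split = applyUpTo-∷ʳ suc m

Good-∷ʳ : ∀ m T E (v : Vec ℕ (suc m)) x →
          Good (suc m) T E (v ∷ʳ x) ⇔
          (x ≡ E × suc m C 2 < T ∸ E × Good m (T ∸ E) (last v) v × last v ≤ E)
Good-∷ʳ m T E v x = mk⇔ ⇒ ⇐
  where
    Decomposed : Set
    Decomposed = x ≡ E × suc m C 2 < T ∸ E × Good m (T ∸ E) (last v) v × last v ≤ E

    sum-prefix : sum (take (suc m) (toList v)) ≡ sum (toList v)
    sum-prefix = cong sum (take-toList v)

    ⇒ : Good (suc m) T E (v ∷ʳ x) → Decomposed
    ⇒ (linked , ps , last≡E , sum≡T) =
      let linkedᵥ , last≤x = Linked-∷ʳ⁻ v x linked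
          psᵥ , c = to (PrefixSumsAbove-suc m (toList v)) (to (PrefixSumsAbove-∷ʳ v x) ps)
      in  x≡E , subst (_ <_) (trans sum-prefix sum-v) c , (linkedᵥ , psᵥ , refl , sum-v)
        , subst (last v ≤_) x≡E last≤x
      where
        x≡E : x ≡ E
        x≡E = trans (sym (last-∷ʳ x v)) last≡E
        sum-v : sum (toList v) ≡ T ∸ E
        sum-v = begin
          sum (toList v)           ≡⟨ m+n∸n≡m (sum (toList v)) x ⟨
          sum (toList v) + x ∸ x   ≡⟨ cong (_∸ x) (trans (sym (sum-∷ʳ v x)) sum≡T) ⟩
          T ∸ x                    ≡⟨ cong (T ∸_) x≡E ⟩
          T ∸ E                    ∎
          where open ≡-Reasoning

    ⇐ : Decomposed → Good (suc m) T E (v ∷ʳ x)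
    ⇐ (refl , c , (linkedᵥ , psᵥ , _ , sum-v) , last≤x) =
      Linked-∷ʳ⁺ v x linkedᵥ last≤x , ps , last-∷ʳ x v , sum≡T
      where
        ps : PrefixSumsAbove (suc m) (toList (v ∷ʳ E))
        ps = from (PrefixSumsAbove-∷ʳ v x) (from (PrefixSumsAbove-suc m (toList v))
               (psᵥ , subst (_ <_) (sym (trans sum-prefix sum-v)) c))
        sum≡T : sum (toList (v ∷ʳ E)) ≡ T
        sum≡T = begin
          sum (toList (v ∷ʳ E))  ≡⟨ sum-∷ʳ v E ⟩
          sum (toList v) + E     ≡⟨ cong (_+ E) sum-v ⟩
          T ∸ E + E              ≡⟨ m∸n+n≡m (<⇒≤ (m∸n≢0⇒n<m {T} {E} (m<n⇒n≢0 c))) ⟩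
          T                      ∎
          where open ≡-Reasoning

Good-last : ∀ m T k (v : Vec ℕ (suc m)) → Good m T k v ⇔ (k ≡ last v × Good m T (last v) v)
Good-last m T k v = mk⇔
  (λ (linked , ps , last≡k , sum≡T) → sym last≡k , (linked , ps , refl , sum≡T))
  (λ { (refl , good) → good })

Good⇒ceilDiv≤last : ∀ m T k (v : Vec ℕ (suc m)) → Good m T k v → ceilDiv T (suc m) ≤ k
Good⇒ceilDiv≤last m T k v (linked , _ , last≡k , sum≡T) =
  ceilDiv-least (subst₂ _≤_ sum≡T (cong (suc m *_) last≡k) (sum≤length*last v linked))

Good⇒entries≤ : ∀ m T k (v : Vec ℕ (suc m)) → Good m T k v → Vecᴬ.All (_≤ T) v
Good⇒entries≤ m T k v (_ , _ , _ , sum≡T) =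
  subst (λ s → Vecᴬ.All (_≤ s) v) sum≡T (entries≤sum v)

G-as-∑ : ∀ m T E → G (suc m) T E ≡ ∑[ v ∈ vecsUpTo T (suc m) ] ind (good? m T E v)
G-as-∑ m T E = length-filter≡∑ (good? m T E) (vecsUpTo T (suc m))

Good-singleton : ∀ T E x → Good 0 T E (x ∷ []) ⇔ (x ≡ T × T ≡ E)
Good-singleton T E x = mk⇔ ⇒ ⇐
  where
    ⇒ : Good 0 T E (x ∷ []) → x ≡ T × T ≡ E
    ⇒ (_ , _ , x≡E , x+0≡T) = x≡T , trans (sym x≡T) x≡E
      where
        x≡T : x ≡ T
        x≡T = trans (sym (+-identityʳ x)) x+0≡T
    ⇐ : x ≡ T × T ≡ E → Good 0 T E (x ∷ [])
    ⇐ (refl , refl) = [-] , [] , refl , +-identityʳ x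

G-one : ∀ T E → G 1 T E ≡ ind (T ≟ E)
G-one T E = begin
  G 1 T E
    ≡⟨ G-as-∑ 0 T E ⟩
  ∑[ v ∈ vecsUpTo T 1 ] ind (good? 0 T E v)
    ≡⟨ ∑-vecsUpTo-∷ T 0 _ ⟩
  ∑[ x ∈ U ] (ind (good? 0 T E (x ∷ [])) + 0)
    ≡⟨ ∑-cong U singleton ⟩
  ∑[ x ∈ U ] ind (x ≟ T) * ind (T ≟ E)
    ≡⟨ ∑-*ʳ U _ (λ x → ind (x ≟ T)) ⟩
  (∑[ x ∈ U ] ind (x ≟ T)) * ind (T ≟ E)
    ≡⟨ cong (_* ind (T ≟ E)) (trans (∑-δ (suc T) T) (ind-yes ≤-refl _)) ⟩
  1 * ind (T ≟ E)
    ≡⟨ *-identityˡ _ ⟩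
  ind (T ≟ E) ∎
  where
    open ≡-Reasoning
    U : List ℕ
    U = upTo (suc T)
    singleton : ∀ x → ind (good? 0 T E (x ∷ [])) + 0 ≡ ind (x ≟ T) * ind (T ≟ E)
    singleton x = trans (+-identityʳ _)
      (trans (ind-cong (Good-singleton T E x) _ (x ≟ T ×-dec T ≟ E)) (ind-× (x ≟ T) (T ≟ E)))

module LastEntry (m T E : ℕ) where

  weight : Vec ℕ (suc m) → ℕ
  weight v = ind (good? m (T ∸ E) (last v) v) * ind (last v ≤? E)

  private
    V : List (Vec ℕ (suc m))
    V = vecsUpTo T (suc m)
    c? : Dec (suc m C 2 < T ∸ E)
    c? = suc m C 2 <? T ∸ E

  -- The factor ind (E <? suc T) appears because vecsUpTo T only enumerates last entries up to T.
  G-split : G (suc (suc m)) T E ≡ ind (E <? suc T) * (ind c? * ∑ V weight)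
  G-split = begin
    G (suc (suc m)) T E
      ≡⟨ G-as-∑ (suc m) T E ⟩
    ∑[ w ∈ vecsUpTo T (suc (suc m)) ] ind (good? (suc m) T E w)
      ≡⟨ ∑-vecsUpTo-∷ʳ T (suc m) _ ⟩
    ∑[ x ∈ U ] ∑[ v ∈ V ] ind (good? (suc m) T E (v ∷ʳ x))
      ≡⟨ ∑-cong U (λ x → ∑-cong V (λ v → ind-good-∷ʳ v x)) ⟩
    ∑[ x ∈ U ] ∑[ v ∈ V ] ind (x ≟ E) * (ind c? * weight v)
      ≡⟨ ∑-cong U (λ x → ∑-*ˡ V (ind (x ≟ E)) _) ⟩
    ∑[ x ∈ U ] ind (x ≟ E) * (∑[ v ∈ V ] ind c? * weight v)
      ≡⟨ ∑-*ʳ U _ (λ x → ind (x ≟ E)) ⟩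
    (∑[ x ∈ U ] ind (x ≟ E)) * (∑[ v ∈ V ] ind c? * weight v)
      ≡⟨ cong₂ _*_ (∑-δ (suc T) E) (∑-*ˡ V (ind c?) weight) ⟩
    ind (E <? suc T) * (ind c? * ∑ V weight) ∎
    where
      open ≡-Reasoning
      U : List ℕ
      U = upTo (suc T)
      ind-good-∷ʳ : ∀ v x → ind (good? (suc m) T E (v ∷ʳ x)) ≡ ind (x ≟ E) * (ind c? * weight v)
      ind-good-∷ʳ v x = begin
        ind (good? (suc m) T E (v ∷ʳ x))
          ≡⟨ ind-cong (Good-∷ʳ m T E v x) _ (x≡E? ×-dec c? ×-dec good-v ×-dec last≤E?) ⟩
        ind (x≡E? ×-dec c? ×-dec good-v ×-dec last≤E?)
          ≡⟨ ind-× x≡E? _ ⟩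
        ind x≡E? * ind (c? ×-dec good-v ×-dec last≤E?)
          ≡⟨ cong (ind x≡E? *_) (ind-× c? _) ⟩
        ind x≡E? * (ind c? * ind (good-v ×-dec last≤E?))
          ≡⟨ cong (λ i → ind x≡E? * (ind c? * i)) (ind-× good-v last≤E?) ⟩
        ind x≡E? * (ind c? * weight v) ∎
        where
          x≡E? : Dec (x ≡ E)
          x≡E? = x ≟ E
          good-v : Dec (Good m (T ∸ E) (last v) v)
          good-v = good? m (T ∸ E) (last v) v
          last≤E? : Dec (last v ≤ E)
          last≤E? = last v ≤? E

  ∑-G-prefix : sumFromTo (ceilDiv (T ∸ E) (suc m)) E (G (suc m) (T ∸ E)) ≡ ∑ V weight
  ∑-G-prefix = begin
    sumFromTo (ceilDiv T′ (suc m)) E (G (suc m) T′)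
      ≡⟨ ∑-upTo-dropInitial (suc E) _ G-below-ceilDiv ⟩
    ∑[ k ∈ K ] G (suc m) T′ k
      ≡⟨ ∑-cong K (G-as-∑ m T′) ⟩
    ∑[ k ∈ K ] ∑[ v ∈ vecsUpTo T′ (suc m) ] ind (good? m T′ k v)
      ≡⟨ ∑-cong K raise-bound ⟨
    ∑[ k ∈ K ] ∑[ v ∈ V ] ind (good? m T′ k v)
      ≡⟨ ∑-comm K V _ ⟩
    ∑[ v ∈ V ] ∑[ k ∈ K ] ind (good? m T′ k v)
      ≡⟨ ∑-cong V weight-as-∑ ⟨
    ∑ V weight ∎
    where
      open ≡-Reasoning
      T′ : ℕ
      T′ = T ∸ E
      K : List ℕ
      K = upTo (suc E)
      G-below-ceilDiv : ∀ {k} → k < ceilDiv T′ (suc m) → G (suc m) T′ k ≡ 0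
      G-below-ceilDiv {k} k<a = trans (G-as-∑ m T′ k) (∑-zero (All.universal not-good (vecsUpTo T′ (suc m))))
        where
          not-good : ∀ v → ind (good? m T′ k v) ≡ 0
          not-good v = ind-no (λ good → <⇒≱ k<a (Good⇒ceilDiv≤last m T′ k v good)) (good? m T′ k v)
      raise-bound : ∀ k → ∑[ v ∈ V ] ind (good? m T′ k v) ≡
                          ∑[ v ∈ vecsUpTo T′ (suc m) ] ind (good? m T′ k v)
      raise-bound k = ∑-vecsUpTo-bound (suc m) _ (m∸n≤m T E)
        (λ v ind≢0 → Good⇒entries≤ m T′ k v (ind≢0⇒ (good? m T′ k v) ind≢0))
      weight-as-∑ : ∀ v → weight v ≡ ∑[ k ∈ K ] ind (good? m T′ k v)
      weight-as-∑ v = sym (begin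
        ∑[ k ∈ K ] ind (good? m T′ k v)
          ≡⟨ ∑-cong K (λ k → trans (ind-cong (Good-last m T′ k v) _ (k ≟ last v ×-dec good-v))
                                   (ind-× (k ≟ last v) good-v)) ⟩
        ∑[ k ∈ K ] ind (k ≟ last v) * ind good-v
          ≡⟨ ∑-*ʳ K (ind good-v) (λ k → ind (k ≟ last v)) ⟩
        (∑[ k ∈ K ] ind (k ≟ last v)) * ind good-v
          ≡⟨ cong (_* ind good-v) (∑-δ (suc E) (last v)) ⟩
        ind (last v <? suc E) * ind good-v
          ≡⟨ cong (_* ind good-v) (ind-cong (mk⇔ m<1+n⇒m≤n s≤s) (last v <? suc E) (last v ≤? E)) ⟩
        ind (last v ≤? E) * ind good-v
          ≡⟨ *-comm (ind (last v ≤? E)) (ind good-v) ⟩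
        weight v ∎)
        where
          good-v : Dec (Good m T′ (last v) v)
          good-v = good? m T′ (last v) v

open LastEntry using (weight; G-split; ∑-G-prefix)

G-recursion : ∀ m T E → suc m C 2 < T ∸ E →
              G (suc (suc m)) T E ≡ sumFromTo (ceilDiv (T ∸ E) (suc m)) E (G (suc m) (T ∸ E))
G-recursion m T E c = begin
  G (suc (suc m)) T E
    ≡⟨ G-split m T E ⟩
  ind (E <? suc T) * (ind (suc m C 2 <? T ∸ E) * S)
    ≡⟨ cong₂ (λ i j → i * (j * S)) (ind-yes E<1+T (E <? suc T)) (ind-yes c (suc m C 2 <? T ∸ E)) ⟩
  1 * (1 * S)
    ≡⟨ trans (*-identityˡ _) (*-identityˡ S) ⟩
  S
    ≡⟨ ∑-G-prefix m T E ⟨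
  sumFromTo (ceilDiv (T ∸ E) (suc m)) E (G (suc m) (T ∸ E)) ∎
  where
    open ≡-Reasoning
    S : ℕ
    S = ∑ (vecsUpTo T (suc m)) (weight m T E)
    E<1+T : E < suc T
    E<1+T = m<n⇒m<1+n (m∸n≢0⇒n<m {T} {E} (m<n⇒n≢0 c))

G-vanishes : ∀ m T E → ¬ (suc m C 2 < T ∸ E) → G (suc (suc m)) T E ≡ 0
G-vanishes m T E ¬c = begin
  G (suc (suc m)) T E
    ≡⟨ G-split m T E ⟩
  ind (E <? suc T) * (ind (suc m C 2 <? T ∸ E) * S)
    ≡⟨ cong (λ j → ind (E <? suc T) * (j * S)) (ind-no ¬c (suc m C 2 <? T ∸ E)) ⟩
  ind (E <? suc T) * 0
    ≡⟨ *-zeroʳ (ind (E <? suc T)) ⟩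
  0 ∎
  where
    open ≡-Reasoning
    S : ℕ
    S = ∑ (vecsUpTo T (suc m)) (weight m T E)

proposition9 :
    ((T E : ℕ) → (T ≡ E → G 1 T E ≡ 1) × (T ≢ E → G 1 T E ≡ 0))
    × ((n T E : ℕ) → 2 ≤ n →
        ((n ∸ 1) C 2 < T ∸ E →
           G n T E ≡ sumFromTo (ceilDiv (T ∸ E) (n ∸ 1)) E (λ k → G (n ∸ 1) (T ∸ E) k))
        × (¬ ((n ∸ 1) C 2 < T ∸ E) → G n T E ≡ 0))
proposition9 = length-one , length-at-least-two
  where
    length-one : (T E : ℕ) → (T ≡ E → G 1 T E ≡ 1) × (T ≢ E → G 1 T E ≡ 0)
    length-one T E = (λ T≡E → trans (G-one T E) (ind-yes T≡E _))
                   , (λ T≢E → trans (G-one T E) (ind-no T≢E _))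
    length-at-least-two : (n T E : ℕ) → 2 ≤ n →
        ((n ∸ 1) C 2 < T ∸ E →
           G n T E ≡ sumFromTo (ceilDiv (T ∸ E) (n ∸ 1)) E (λ k → G (n ∸ 1) (T ∸ E) k))
        × (¬ ((n ∸ 1) C 2 < T ∸ E) → G n T E ≡ 0)
    length-at-least-two (suc zero)    T E (s≤s ())
    length-at-least-two (suc (suc m)) T E _ = G-recursion m T E , G-vanishes m T E
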